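{- Let $T$ be a pre-Galois word and $p_e=\mathrm{Per}_e(T)$. Let $z$ be a symbol and $T'=T\cdot z$ with $T'[1..|T|-p_e+1]\prec_{\mathrm{alt}}T'[p_e+1..|T|+1]$. Then $\mathrm{Per}_e(T')=|T'|$ if $|T'|$ is even, and $\mathrm{Per}_e(T')=|T'|+1$ otherwise.
   Context: $W[i..j]$ is the factor from position $i$ to $j$ (1-indexed), and is $\varepsilon$ if $i>j$. An integer $p\in[1..|W|]$ is a period of $W$ if $W[i+p]=W[i]$ for all $i\in[1..|W|-p]$. $\mathrm{Per}_e(W)$ is the shortest even period of $W$, set to $|W|+1$ if none exists. Alternating order: for words $S,T$ with $S^\omega\neq T^\omega$ ($X^\omega$ the infinite repetition of $X$), let $j$ be the first position with $S^\omega[j]\neq T^\omega[j]$; $S\prec_{\mathrm{alt}}T$ if $j$ is odd and $S^\omega[j]<T^\omega[j]$, or $j$ is even and $S^\omega[j]>T^\omega[j]$. $S=_{\mathrm{alt}}T$ if $S^\omega=T^\omega$; $\varepsilon\succ_{\mathrm{alt}}X$ for every nonempty $X$. A word $T$ is pre-Galois if every proper suffix $S$ of $T$ is a prefix of $T$ or satisfies $S\succ_{\mathrm{alt}}T$. -}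

module Defs where

open import Data.Nat using (ℕ; zero; suc; _+_; _*_; _∸_; _≤_; _<_)
open import Data.Nat.DivMod using (_%_)
open import Data.Nat.Divisibility using (_∣_)
open import Data.List using (List; []; _∷_; length; _++_; take; drop)
open import Data.Maybe using (Maybe; just; nothing)
open import Data.Product using (Σ; ∃; _×_)
open import Data.Sum using (_⊎_)
open import Relation.Binary.PropositionalEquality using (_≡_; _≢_)
open import Relation.Nullary using (¬_)

Word : Set
Word = List ℕ

Even : ℕ → Set
Even n = 2 ∣ n

-- 0-indexed access: at W i = W[i+1] (1-indexed), nothing if out of range
at : Word → ℕ → Maybe ℕ
at []       _       = nothing
at (x ∷ xs) zero    = just x
at (x ∷ xs) (suc i) = at xs i

-- Factor W[i..j] (1-indexed, ε if i > j)
factor : Word → ℕ → ℕ → Word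
factor W i j = drop (i ∸ 1) (take j W)

IsPeriod : Word → ℕ → Set
IsPeriod W p = 1 ≤ p × p ≤ length W ×
  (∀ i → i + p < length W → at W (i + p) ≡ at W i)

IsPerE : Word → ℕ → Set
IsPerE W q =
    (Even q × IsPeriod W q × (∀ p → Even p → IsPeriod W p → q ≤ p))
  ⊎ ((∀ p → Even p → ¬ IsPeriod W p) × q ≡ suc (length W))

-- X^ω at 0-indexed position j (X^ω[j+1] in 1-indexed notation);
-- nothing iff X is empty
omega : Word → ℕ → Maybe ℕ
omega []       _ = nothing
omega (x ∷ xs) j = at (x ∷ xs) (j % suc (length xs))

-- Case 1: T = ε and S nonempty (ε ≻alt X for every nonempty X).
-- Case 2: S, T nonempty, j (0-indexed) is the first position where S^ω and T^ω
-- differ; 1-indexed position j+1 is odd iff j is even.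
_≺alt_ : Word → Word → Set
S ≺alt T =
    (S ≢ [] × T ≡ [])
  ⊎ (Σ ℕ λ j → Σ ℕ λ x → Σ ℕ λ y →
       (∀ k → k < j → omega S k ≡ omega T k) ×
       omega S j ≡ just x × omega T j ≡ just y ×
       (Even j → x < y) × (¬ Even j → y < x))

IsPrefix : Word → Word → Set
IsPrefix S T = ∃ λ R → S ++ R ≡ T

PreGalois : Word → Set
PreGalois T = ∀ k → 1 ≤ k → k ≤ length T →
  IsPrefix (drop k T) T ⊎ (T ≺alt drop k T)

{-# OPTIONS --safe #-}
-- If T has no even period, the left factor in the hypothesis is empty and cannot be
-- ≺alt-smaller. Otherwise let n = |T| and m = n - pe. As pe is a period of T, the two factors
-- coincide except for their last letters a = T[m+1] and z, so the hypothesis says that a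
-- precedes z in the alternating order at position m + 1. Suppose T·z had an even period
-- p ≤ n. Then p is an even period of T, so p = pe + r with r even, and T·z has the letter z
-- at position n - p + 1 = m - r + 1. Combining the periods pe and p, T and its suffix
-- T[r+1..n] agree on their first m - r letters and then carry z and a respectively; so r > 0
-- (else a = z), and the pre-Galois property forces z to precede a at position m - r + 1,
-- which has the same parity as m + 1. Hence |T·z| is the only candidate for an even period.
module Submission where

open import Defs
open import Data.Nat using (ℕ; zero; suc; _+_; _∸_; _≤_; _<_; z≤n; s≤s; _≟_)
open import Data.Nat.Properties
open import Data.Nat.DivMod using (m<n⇒m%n≡m)
open import Data.Nat.Divisibility using (_∣?_; ∣m∣n⇒∣m+n; ∣m+n∣m⇒∣n)
open import Data.List using ([]; _∷_; length; _++_; [_]; take; drop)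
open import Data.List.Properties using (length-++; length-take; length-drop; take-all)
open import Data.Maybe using (just)
open import Data.Maybe.Properties using (just-injective)
open import Data.Product using (_×_; _,_; ∃; proj₁; proj₂)
open import Data.Sum using (inj₁; inj₂)
open import Data.Empty using (⊥-elim)
open import Relation.Binary using (tri<; tri≈; tri>)
open import Relation.Binary.PropositionalEquality
  using (_≡_; _≢_; refl; sym; trans; cong; cong₂; subst; subst₂; module ≡-Reasoning)
open import Relation.Nullary using (¬_; yes; no)

private
  variable
    S R W : Word
    j m p u v x y : ℕ

AltLess : ℕ → ℕ → ℕ → Set
AltLess j x y = (Even j → x < y) × (¬ Even j → y < x)

AltLess-asym : AltLess j x y → ¬ AltLess j y x
AltLess-asym {j} (x<y , y<x) (y<x′ , x<y′) with 2 ∣? j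
... | yes even = <-asym (x<y even) (y<x′ even)
... | no odd   = <-asym (y<x odd) (x<y′ odd)

AltLess⇒≢ : AltLess j x y → x ≢ y
AltLess⇒≢ x<y refl = AltLess-asym x<y x<y

AltLess-cancel-even : ∀ {r} → Even r → AltLess (r + j) x y → AltLess j x y
AltLess-cancel-even even-r (x<y , y<x) =
  (λ even → x<y (∣m∣n⇒∣m+n even-r even)) , (λ odd → y<x (λ even → odd (∣m+n∣m⇒∣n even even-r)))

at≡just⇒< : ∀ (W : Word) {i x} → at W i ≡ just x → i < length W
at≡just⇒< (w ∷ W) {zero}  _   = s≤s z≤n
at≡just⇒< (w ∷ W) {suc i} eq = s≤s (at≡just⇒< W eq)

at-in-range : ∀ (W : Word) {i} → i < length W → ∃ λ x → at W i ≡ just x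
at-in-range (w ∷ W) {zero}  _         = w , refl
at-in-range (w ∷ W) {suc i} (s≤s i<n) = at-in-range W i<n

at-++ˡ : ∀ (W V : Word) {i} → i < length W → at (W ++ V) i ≡ at W i
at-++ˡ (w ∷ W) V {zero}  _         = refl
at-++ˡ (w ∷ W) V {suc i} (s≤s i<n) = at-++ˡ W V i<n

at-snoc-length : ∀ (W : Word) z → at (W ++ [ z ]) (length W) ≡ just z
at-snoc-length []      z = refl
at-snoc-length (w ∷ W) z = at-snoc-length W z

at-take : ∀ n (W : Word) {i} → i < n → at (take n W) i ≡ at W i
at-take (suc n) []      _         = refl
at-take (suc n) (w ∷ W) {zero}  _         = refl
at-take (suc n) (w ∷ W) {suc i} (s≤s i<n) = at-take n W i<n

at-drop : ∀ n (W : Word) i → at (drop n W) i ≡ at W (n + i)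
at-drop zero    W       i = refl
at-drop (suc n) []      i = refl
at-drop (suc n) (w ∷ W) i = at-drop n W i

at-ext : ∀ (S R : Word) → length S ≡ length R → (∀ k → k < length S → at S k ≡ at R k) → S ≡ R
at-ext []      []      _  _     = refl
at-ext (s ∷ S) (r ∷ R) eq agree =
  cong₂ _∷_ (just-injective (agree 0 (s≤s z≤n)))
            (at-ext S R (suc-injective eq) (λ k k<n → agree (suc k) (s≤s k<n)))

length-snoc : ∀ (W : Word) z → length (W ++ [ z ]) ≡ suc (length W)
length-snoc W z = trans (length-++ W) (+-comm (length W) 1)

omega-in-range : ∀ (W : Word) {i} → i < length W → omega W i ≡ at W i
omega-in-range (w ∷ W) i<n = cong (at (w ∷ W)) (m<n⇒m%n≡m i<n)

omega-letter≡at-letter : ∀ (W : Word) {i x y} → omega W i ≡ just x → at W i ≡ just y → x ≡ y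
omega-letter≡at-letter W ωx aty =
  just-injective (trans (sym ωx) (trans (omega-in-range W (at≡just⇒< W aty)) aty))

[]⊀alt : ¬ ([] ≺alt R)
[]⊀alt (inj₁ ([]≢[] , _)) = []≢[] refl
[]⊀alt (inj₂ (_ , _ , _ , _ , () , _))

≺alt-irrefl : ¬ (W ≺alt W)
≺alt-irrefl (inj₁ (W≢[] , W≡[])) = W≢[] W≡[]
≺alt-irrefl (inj₂ (_ , _ , _ , _ , ωx , ωy , x<y , y<x)) =
  AltLess⇒≢ (x<y , y<x) (just-injective (trans (sym ωx) ωy))

-- Within range, S^ω and R^ω are S and R, so their first difference is the first mismatch m.
≺alt⇒AltLess : S ≺alt R → (∀ k → k < m → at S k ≡ at R k) →
  at S m ≡ just u → at R m ≡ just v → u ≢ v → AltLess m u v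
≺alt⇒AltLess (inj₁ (_ , refl)) _ _ () _
≺alt⇒AltLess {S} {R} {m} {u} {v} (inj₂ (j , x , y , ω-agree , ωx , ωy , x<y , y<x)) agree atu atv u≢v
  with <-cmp j m
... | tri< j<m _ _ = ⊥-elim (AltLess⇒≢ (x<y , y<x) (just-injective (begin
      just x      ≡⟨ sym ωx ⟩
      omega S j   ≡⟨ omega-in-range S (<-trans j<m (at≡just⇒< S atu)) ⟩
      at S j      ≡⟨ agree j j<m ⟩
      at R j      ≡⟨ sym (omega-in-range R (<-trans j<m (at≡just⇒< R atv))) ⟩
      omega R j   ≡⟨ ωy ⟩
      just y      ∎)))
  where open ≡-Reasoning
... | tri≈ _ refl _ =
  subst₂ (AltLess m) (omega-letter≡at-letter S ωx atu) (omega-letter≡at-letter R ωy atv) (x<y , y<x)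
... | tri> _ _ m<j = ⊥-elim (u≢v (just-injective (begin
      just u      ≡⟨ sym atu ⟩
      at S m      ≡⟨ sym (omega-in-range S (at≡just⇒< S atu)) ⟩
      omega S m   ≡⟨ ω-agree m m<j ⟩
      omega R m   ≡⟨ omega-in-range R (at≡just⇒< R atv) ⟩
      at R m      ≡⟨ atv ⟩
      just v      ∎)))
  where open ≡-Reasoning

≺alt⇒AltLess-last : length S ≡ suc m → length R ≡ suc m → (∀ k → k < m → at S k ≡ at R k) →
  at S m ≡ just u → at R m ≡ just v → S ≺alt R → AltLess m u v
≺alt⇒AltLess-last {S} {m} {R} {u} {v} |S| |R| agree atu atv S≺R with u ≟ v
... | no u≢v   = ≺alt⇒AltLess S≺R agree atu atv u≢v
... | yes refl = ⊥-elim (≺alt-irrefl (subst (_≺alt R) S≡R S≺R))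
  where
    agree-everywhere : ∀ k → k < length S → at S k ≡ at R k
    agree-everywhere k k<|S| with m≤n⇒m<n∨m≡n (≤-pred (subst (k <_) |S| k<|S|))
    ... | inj₁ k<m  = agree k k<m
    ... | inj₂ refl = trans atu (sym atv)
    S≡R : S ≡ R
    S≡R = at-ext S R (trans |S| (sym |R|)) agree-everywhere

PreGalois⇒AltLess : ∀ {r} → PreGalois W → 1 ≤ r → (∀ k → k < m → at W k ≡ at W (r + k)) →
  at W m ≡ just u → at W (r + m) ≡ just v → u ≢ v → AltLess m u v
PreGalois⇒AltLess {W} {m} {u} {v} {r} pg 1≤r agree atu atv u≢v
  with pg r 1≤r (m+n≤o⇒m≤o r (<⇒≤ (at≡just⇒< W atv)))
... | inj₁ (V , D++V≡W) = ⊥-elim (u≢v (just-injective (begin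
      just u            ≡⟨ sym atu ⟩
      at W m            ≡⟨ cong (λ X → at X m) (sym D++V≡W) ⟩
      at (D ++ V) m     ≡⟨ at-++ˡ D V (at≡just⇒< D atv′) ⟩
      at D m            ≡⟨ atv′ ⟩
      just v            ∎)))
  where
    open ≡-Reasoning
    D = drop r W
    atv′ : at D m ≡ just v
    atv′ = trans (at-drop r W m) atv
... | inj₂ W≺D = ≺alt⇒AltLess W≺D (λ k k<m → trans (agree k k<m) (sym (at-drop r W k)))
                   atu (trans (at-drop r W m) atv) u≢v

PreGalois⇒¬AltLess-even-shift : ∀ {r} → PreGalois W → Even r → (∀ k → k < m → at W k ≡ at W (r + k)) →
  at W m ≡ just u → at W (r + m) ≡ just v → ¬ AltLess (r + m) v u
PreGalois⇒¬AltLess-even-shift {r = zero} _ _ _ atu atv v<u =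
  AltLess⇒≢ v<u (just-injective (trans (sym atv) atu))
PreGalois⇒¬AltLess-even-shift {r = suc _} pg even-r agree atu atv v<u =
  AltLess-asym (AltLess-cancel-even even-r v<u)
               (PreGalois⇒AltLess pg (s≤s z≤n) agree atu atv (λ u≡v → AltLess⇒≢ v<u (sym u≡v)))

IsPeriod-snoc⇒IsPeriod : ∀ (W : Word) z → IsPeriod (W ++ [ z ]) p → p ≤ length W → IsPeriod W p
IsPeriod-snoc⇒IsPeriod {p} W z (1≤p , _ , per) p≤n = 1≤p , p≤n , λ i i+p<n → begin
  at W (i + p)              ≡⟨ sym (at-++ˡ W [ z ] i+p<n) ⟩
  at (W ++ [ z ]) (i + p)   ≡⟨ per i (<-trans i+p<n (≤-reflexive (sym (length-snoc W z)))) ⟩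
  at (W ++ [ z ]) i         ≡⟨ at-++ˡ W [ z ] (≤-<-trans (m≤m+n i p) i+p<n) ⟩
  at W i                    ∎
  where open ≡-Reasoning

IsPeriod-snoc⇒at : ∀ (W : Word) z → IsPeriod (W ++ [ z ]) p → p ≤ length W →
  at W (length W ∸ p) ≡ just z
IsPeriod-snoc⇒at {p} W z (1≤p , _ , per) p≤n = begin
  at W k                     ≡⟨ sym (at-++ˡ W [ z ] (∸-monoʳ-< 1≤p p≤n)) ⟩
  at (W ++ [ z ]) k          ≡⟨ sym (per k (subst₂ _<_ (sym k+p≡n) (sym (length-snoc W z)) ≤-refl)) ⟩
  at (W ++ [ z ]) (k + p)    ≡⟨ cong (at (W ++ [ z ])) k+p≡n ⟩
  at (W ++ [ z ]) (length W) ≡⟨ at-snoc-length W z ⟩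
  just z                     ∎
  where
    open ≡-Reasoning
    k = length W ∸ p
    k+p≡n : k + p ≡ length W
    k+p≡n = m∸n+n≡m p≤n

IsPeriod-shift : ∀ (W : Word) {q r} → IsPeriod W q → IsPeriod W (q + r) →
  ∀ k → k + (q + r) < length W → at W k ≡ at W (r + k)
IsPeriod-shift W {q} {r} (_ , _ , per-q) (_ , _ , per-q+r) k k+q+r<n = begin
  at W k              ≡⟨ sym (per-q+r k k+q+r<n) ⟩
  at W (k + (q + r))  ≡⟨ cong (at W) reassoc ⟩
  at W (r + k + q)    ≡⟨ per-q (r + k) (subst (_< length W) reassoc k+q+r<n) ⟩
  at W (r + k)        ∎
  where
    open ≡-Reasoning
    reassoc : k + (q + r) ≡ r + k + q
    reassoc = begin
      k + (q + r)  ≡⟨ cong (k +_) (+-comm q r) ⟩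
      k + (r + q)  ≡⟨ sym (+-assoc k r q) ⟩
      k + r + q    ≡⟨ cong (_+ q) (+-comm k r) ⟩
      r + k + q    ∎

NoProperEvenPeriod : Word → Set
NoProperEvenPeriod W = ∀ p → Even p → IsPeriod W p → ¬ p < length W

IsPerE-length-even : 0 < length W → Even (length W) → NoProperEvenPeriod W → IsPerE W (length W)
IsPerE-length-even {W} 0<n even noProper =
  inj₁ (even , (0<n , ≤-refl , λ i i+n<n → ⊥-elim (m+n≮n i (length W) i+n<n))
       , λ p even-p per → ≮⇒≥ (noProper p even-p per))

IsPerE-length-odd : ¬ Even (length W) → NoProperEvenPeriod W → IsPerE W (suc (length W))
IsPerE-length-odd {W} odd noProper = inj₂ (no-even-period , refl)
  where
    no-even-period : ∀ p → Even p → ¬ IsPeriod W p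
    no-even-period p even-p per@(_ , p≤n , _) with m≤n⇒m<n∨m≡n p≤n
    ... | inj₁ p<n  = noProper p even-p per p<n
    ... | inj₂ refl = odd even-p

-- Both factors have length |W| - q + 1 and, q being a period of W, differ only in their last letter.
shifted-factors⇒AltLess : ∀ (W : Word) q z → IsPeriod W q →
  factor (W ++ [ z ]) 1 (length W + 1 ∸ q) ≺alt factor (W ++ [ z ]) (q + 1) (length W + 1) →
  ∃ λ a → at W (length W ∸ q) ≡ just a × AltLess (length W ∸ q) a z
shifted-factors⇒AltLess W q z (1≤q , q≤n , per) S≺R =
  a , ata , ≺alt⇒AltLess-last |S| |R| agree atS atR (subst₂ _≺alt_ S≡ R≡ S≺R)
  where
    open ≡-Reasoning
    n = length W
    k = n ∸ q
    W′ = W ++ [ z ]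
    k<n : k < n
    k<n = ∸-monoʳ-< 1≤q q≤n
    n+1∸q≡1+k : n + 1 ∸ q ≡ suc k
    n+1∸q≡1+k = trans (+-∸-comm 1 q≤n) (+-comm k 1)
    S≡ : factor W′ 1 (n + 1 ∸ q) ≡ take (suc k) W′
    S≡ = cong (λ l → take l W′) n+1∸q≡1+k
    R≡ : factor W′ (q + 1) (n + 1) ≡ drop q W′
    R≡ = cong₂ drop (m+n∸n≡m q 1) (take-all (n + 1) W′ (≤-reflexive (length-++ W)))
    |S| : length (take (suc k) W′) ≡ suc k
    |S| = trans (length-take (suc k) W′)
                (m≤n⇒m⊓n≡m (subst (suc k ≤_) (sym (length-snoc W z)) (s≤s (<⇒≤ k<n))))
    |R| : length (drop q W′) ≡ suc k
    |R| = trans (length-drop q W′) (trans (cong (_∸ q) (length-++ W)) n+1∸q≡1+k)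
    a,ata = at-in-range W k<n
    a = proj₁ a,ata
    ata = proj₂ a,ata
    atS : at (take (suc k) W′) k ≡ just a
    atS = trans (at-take (suc k) W′ ≤-refl) (trans (at-++ˡ W [ z ] k<n) ata)
    atR : at (drop q W′) k ≡ just z
    atR = begin
      at (drop q W′) k  ≡⟨ at-drop q W′ k ⟩
      at W′ (q + k)     ≡⟨ cong (at W′) (m+[n∸m]≡n q≤n) ⟩
      at W′ n           ≡⟨ at-snoc-length W z ⟩
      just z            ∎
    agree : ∀ i → i < k → at (take (suc k) W′) i ≡ at (drop q W′) i
    agree i i<k = begin
      at (take (suc k) W′) i  ≡⟨ at-take (suc k) W′ (m<n⇒m<1+n i<k) ⟩
      at W′ i                 ≡⟨ at-++ˡ W [ z ] (<-trans i<k k<n) ⟩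
      at W i                  ≡⟨ sym (per i i+q<n) ⟩
      at W (i + q)            ≡⟨ cong (at W) (+-comm i q) ⟩
      at W (q + i)            ≡⟨ sym (at-++ˡ W [ z ] (subst (_< n) (+-comm i q) i+q<n)) ⟩
      at W′ (q + i)           ≡⟨ sym (at-drop q W′ i) ⟩
      at (drop q W′) i        ∎
      where
        i+q<n : i + q < n
        i+q<n = subst (i + q <_) (m∸n+n≡m q≤n) (+-monoˡ-< q i<k)

snoc-NoProperEvenPeriod : ∀ (W : Word) pe z → PreGalois W →
  Even pe → IsPeriod W pe → (∀ p → Even p → IsPeriod W p → pe ≤ p) →
  (∃ λ a → at W (length W ∸ pe) ≡ just a × AltLess (length W ∸ pe) a z) →
  NoProperEvenPeriod (W ++ [ z ])
snoc-NoProperEvenPeriod W pe z pg even-pe per-pe min-pe (a , ata , a<z) p even-p per-p p<|W′| =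
  PreGalois⇒¬AltLess-even-shift pg even-r agree (IsPeriod-snoc⇒at W z per-p p≤n) ata′ a<z′
  where
    open ≡-Reasoning
    n = length W
    p≤n : p ≤ n
    p≤n = ≤-pred (subst (p <_) (length-snoc W z) p<|W′|)
    per-p-W : IsPeriod W p
    per-p-W = IsPeriod-snoc⇒IsPeriod W z per-p p≤n
    r = p ∸ pe
    k = n ∸ p
    pe+r≡p : pe + r ≡ p
    pe+r≡p = m+[n∸m]≡n (min-pe p even-p per-p-W)
    even-r : Even r
    even-r = ∣m+n∣m⇒∣n (subst Even (sym pe+r≡p) even-p) even-pe
    agree : ∀ i → i < k → at W i ≡ at W (r + i)
    agree i i<k = IsPeriod-shift W per-pe (subst (IsPeriod W) (sym pe+r≡p) per-p-W) i
      (subst (λ l → i + l < n) (sym pe+r≡p) (subst (i + p <_) (m∸n+n≡m p≤n) (+-monoˡ-< p i<k)))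
    n∸pe≡r+k : n ∸ pe ≡ r + k
    n∸pe≡r+k = begin
      n ∸ pe             ≡⟨ cong (_∸ pe) (sym (m+[n∸m]≡n p≤n)) ⟩
      p + k ∸ pe         ≡⟨ cong (λ l → l + k ∸ pe) (sym pe+r≡p) ⟩
      pe + r + k ∸ pe    ≡⟨ cong (_∸ pe) (+-assoc pe r k) ⟩
      pe + (r + k) ∸ pe  ≡⟨ m+n∸m≡n pe (r + k) ⟩
      r + k              ∎
    ata′ : at W (r + k) ≡ just a
    ata′ = subst (λ l → at W l ≡ just a) n∸pe≡r+k ata
    a<z′ : AltLess (r + k) a z
    a<z′ = subst (λ l → AltLess l a z) n∸pe≡r+k a<z

lemma24 : (T : Word) (pe : ℕ) (z : ℕ) → PreGalois T → IsPerE T pe →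
    factor (T ++ [ z ]) 1 (length T + 1 ∸ pe) ≺alt factor (T ++ [ z ]) (pe + 1) (length T + 1) →
    (Even (length (T ++ [ z ])) → IsPerE (T ++ [ z ]) (length (T ++ [ z ])))
    × (¬ Even (length (T ++ [ z ])) → IsPerE (T ++ [ z ]) (suc (length (T ++ [ z ]))))
lemma24 T pe z pg (inj₂ (_ , refl)) S≺R = ⊥-elim ([]⊀alt (subst (_≺alt suffix) S≡[] S≺R))
  where
    suffix = factor (T ++ [ z ]) (suc (length T) + 1) (length T + 1)
    S≡[] : factor (T ++ [ z ]) 1 (length T + 1 ∸ suc (length T)) ≡ []
    S≡[] = cong (λ l → take l (T ++ [ z ])) (m≤n⇒m∸n≡0 (≤-reflexive (+-comm (length T) 1)))
lemma24 T pe z pg (inj₁ (even-pe , per-pe , min-pe)) S≺R =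
    (λ even → IsPerE-length-even {T′} 0<|T′| even noProper)
  , (λ odd → IsPerE-length-odd {T′} odd noProper)
  where
    T′ = T ++ [ z ]
    noProper : NoProperEvenPeriod T′
    noProper = snoc-NoProperEvenPeriod T pe z pg even-pe per-pe min-pe
                 (shifted-factors⇒AltLess T pe z per-pe S≺R)
    0<|T′| : 0 < length T′
    0<|T′| = subst (0 <_) (sym (length-snoc T z)) (s≤s z≤n)
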